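{- Let $((A_i,B_i))_{i\in\mathbb N}$ be a strictly increasing sequence of tight oriented separations of a connected locally finite graph $G$, let $(A,B)=(\bigcup_iA_i,\bigcap_iB_i)$ be its limit, and let $(C,D)$ be any finite-order oriented separation of $G$. If $((A_i,B_i))_{i}$ is non-exhaustive (i.e. $B\ne\emptyset$) and $(C,D)\le(A,B)$, then there exists $I\in\mathbb N$ such that $(C,D)\le(A_I,B_I)$.
   Context: A separation of a graph $G$ is an unordered pair $\{A,B\}$ of subsets of $V(G)$ with $A\cup B=V(G)$ and no edge between $A\setminus B$ and $B\setminus A$; its order is $|A\cap B|$; oriented separations are ordered by $(A,B)\le(C,D)$ iff $A\subseteq C$ and $B\supseteq D$. For $X\subseteq V(G)$, a component $K$ of $G-X$ is tight if $N_G(K)=X$. A separation $\{A,B\}$ is tight if both $A\setminus B$ and $B\setminus A$ contain the vertex set of a tight component of $G-(A\cap B)$. -}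

module Defs where

open import Level using (0ℓ)
open import Data.Nat using (ℕ; _<_)
open import Data.Product using (Σ; ∃; _×_; _,_)
open import Data.Sum using (_⊎_)
open import Data.Unit using (⊤)
open import Data.List using (List)
open import Data.List.Membership.Propositional using (_∈_)
open import Relation.Nullary using (¬_)
open import Relation.Binary.PropositionalEquality using (_≡_)
open import Function.Bundles using (_⇔_)

Subset : Set → Set₁
Subset V = V → Set

record Graph : Set₁ where
  field
    V     : Set
    _~_   : V → V → Set
    ~-sym : ∀ {u v} → u ~ v → v ~ u
    ~-irr : ∀ {v} → ¬ (v ~ v)

module _ (G : Graph) where
  open Graph G

  _⊆_ : Subset V → Subset V → Set
  X ⊆ Y = ∀ v → X v → Y v

  _≐_ : Subset V → Subset V → Set
  X ≐ Y = (X ⊆ Y) × (Y ⊆ X)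

  FiniteSet : Subset V → Set
  FiniteSet X = Σ (List V) λ L → ∀ v → X v ⇔ (v ∈ L)

  data Walk (S : Subset V) : V → V → Set where
    []  : ∀ {u} → S u → Walk S u u
    step : ∀ {u v w} → S u → u ~ v → Walk S v w → Walk S u w

  LocallyFinite : Set
  LocallyFinite = ∀ v → FiniteSet (λ w → v ~ w)

  Connected : Set
  Connected = ∀ u v → Walk (λ _ → ⊤) u v

  Minus : Subset V → Subset V
  Minus X v = ¬ X v

  ConnectedIn : Subset V → Set
  ConnectedIn K = ∀ u v → K u → K v → Walk K u v

  IsComponent : Subset V → Subset V → Set₁
  IsComponent X K =
    (∃ λ v → K v) × (K ⊆ Minus X) × ConnectedIn K ×
    (∀ (K' : Subset V) → K ⊆ K' → K' ⊆ Minus X → ConnectedIn K' → K' ⊆ K)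

  N : Subset V → Subset V
  N K v = ¬ K v × ∃ λ u → K u × (u ~ v)

  IsTightComponent : Subset V → Subset V → Set₁
  IsTightComponent X K = IsComponent X K × (N K ≐ X)

  record OSep : Set₁ where
    constructor _,_
    field
      A : Subset V
      B : Subset V

  Sep∩ : OSep → Subset V
  Sep∩ (A , B) v = A v × B v

  IsSeparation : OSep → Set
  IsSeparation (A , B) =
    (∀ v → A v ⊎ B v) ×
    (∀ u v → A u → ¬ B u → B v → ¬ A v → ¬ (u ~ v))

  FiniteOrder : OSep → Set
  FiniteOrder s = FiniteSet (Sep∩ s)

  IsTight : OSep → Set₁
  IsTight (A , B) =
    (∃ λ K → IsTightComponent (Sep∩ (A , B)) K × (K ⊆ (λ v → A v × ¬ B v))) ×
    (∃ λ K → IsTightComponent (Sep∩ (A , B)) K × (K ⊆ (λ v → B v × ¬ A v)))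

  _≤s_ : OSep → OSep → Set
  (A , B) ≤s (C , D) = (A ⊆ C) × (D ⊆ B)

  _≡s_ : OSep → OSep → Set
  (A , B) ≡s (C , D) = (A ≐ C) × (B ≐ D)

  _<s_ : OSep → OSep → Set
  s <s t = (s ≤s t) × ¬ (s ≡s t)

  StrictlyIncreasing : (ℕ → OSep) → Set
  StrictlyIncreasing s = ∀ i j → i < j → s i <s s j

  limit : (ℕ → OSep) → OSep
  limit s = (λ v → ∃ λ i → OSep.A (s i) v) , (λ v → ∀ i → OSep.B (s i) v)

  NonExhaustive : (ℕ → OSep) → Set
  NonExhaustive s = ∃ λ v → OSep.B (limit s) v

{-# OPTIONS --safe #-}
module Submission where

-- Choose I so large that A_I contains the finite separator X = C ∩ D together with its
-- neighbours in C ∖ D (local finiteness makes this finitely many vertices of C ⊆ ⋃ A_i).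
-- Let T ⊆ B_I ∖ A_I be a tight component of G - (A_I ∩ B_I). As T avoids X ⊆ A_I and is
-- connected, it lies entirely in D or entirely outside D. If T ⊆ D, every vertex of the
-- separator A_I ∩ B_I has a neighbour in T, hence lies in D; a walk from some b ∈ B_I ∖ D
-- to T leaves C ∖ D at a neighbour of X, which lies in A_I, so before that it crosses
-- A_I ∩ B_I outside D. Hence B_I ⊆ D, and then C ⊆ A_I. If T ⊆ C ∖ D, the separator
-- A_I ∩ B_I misses D, yet a walk inside D from a vertex of B ∩ D ⊆ B_I to X ⊆ A_I must
-- cross it.

open import Defs
open import Level using (0ℓ; lift; lower)
open import Data.Nat using (ℕ; _≤_; _⊔_)
open import Data.Nat.Properties using (m≤n⇒m<n∨m≡n; m≤m⊔n; m≤n⊔m)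
open import Data.Product using (∃; ∃₂; _×_; _,_; proj₁; proj₂)
open import Data.Sum using (inj₁; inj₂; swap; fromInj₁)
open import Data.Empty using (⊥-elim)
open import Data.List using (List; []; _∷_)
open import Data.List.Membership.Propositional using (_∈_)
open import Data.List.Relation.Unary.Any using (here; there)
open import Relation.Nullary using (¬_; Dec; yes; no)
open import Relation.Nullary.Decidable using (map′; decidable-stable)
open import Relation.Binary.PropositionalEquality using (refl)
open import Function.Bundles using (Equivalence)
open import Axiom.ExcludedMiddle using (ExcludedMiddle)

module _ {X : Set} (P : ℕ → X → Set) (mono : ∀ {i j x} → i ≤ j → P i x → P j x) where

  eventually-all : (L : List X) → (∀ x → x ∈ L → ∃ λ i → P i x) →
                   ∃ λ I → ∀ x → x ∈ L → P I x
  eventually-all [] _ = 0 , λ _ ()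
  eventually-all (y ∷ L) h with h y (here refl) | eventually-all L (λ x x∈L → h x (there x∈L))
  ... | i , Py | I , PL = i ⊔ I , λ where
    _ (here refl) → mono (m≤m⊔n i I) Py
    x (there x∈L) → mono (m≤n⊔m i I) (PL x x∈L)

module _ (G : Graph) where
  open Graph G

  Absorbs : OSep G → OSep G → Set
  Absorbs (A , B) (C , D) =
    (∀ x → C x → D x → A x) × (∀ x y → C x → D x → x ~ y → ¬ D y → A y)

module Classical (em : ExcludedMiddle (Level.suc 0ℓ)) (G : Graph) where
  open Graph G

  dec : (P : Set) → Dec P
  dec P = map′ lower lift em

  stable : {P : Set} → ¬ ¬ P → P
  stable {P} = decidable-stable (dec P)

  walk-start : ∀ {S u w} → Walk G S u w → S u
  walk-start ([] Su) = Su
  walk-start (step Su _ _) = Su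

  walk-end : ∀ {S u w} → Walk G S u w → S w
  walk-end ([] Sw) = Sw
  walk-end (step _ _ W) = walk-end W

  walk-preserves : ∀ {S u w} (P : Subset V) →
    (∀ {x y} → S x → S y → x ~ y → P x → P y) → Walk G S u w → P u → P w
  walk-preserves P _ ([] _) Pu = Pu
  walk-preserves P pres (step Su uv W) Pu = walk-preserves P pres W (pres Su (walk-start W) uv Pu)

  exit : ∀ {S u w} (P : Subset V) → Walk G S u w → P u → ¬ P w →
         ∃₂ λ p q → Walk G (λ x → S x × P x) u p × ¬ P q × p ~ q
  exit P ([] _) Pu ¬Pw = ⊥-elim (¬Pw Pu)
  exit P (step {u = u} {v = v} Su uv W) Pu ¬Pw with dec (P v)
  ... | no ¬Pv = u , v , [] (Su , Pu) , ¬Pv , uv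
  ... | yes Pv with exit P W Pv ¬Pw
  ...   | p , q , W′ , ¬Pq , pq = p , q , step (Su , Pu) uv W′ , ¬Pq , pq

  IsSeparation-swap : ∀ {A B} → IsSeparation G (A , B) → IsSeparation G (B , A)
  IsSeparation-swap (cover , sep) =
    (λ v → swap (cover v)) ,
    λ u v Bu ¬Au Av ¬Bv uv → sep v u Av ¬Bv Bu ¬Au (~-sym uv)

  neighbour∈A : ∀ {A B} → IsSeparation G (A , B) → ∀ {u w} → u ~ w → ¬ B u → A w
  neighbour∈A (cover , sep) {u} {w} uw ¬Bu = stable λ ¬Aw →
    sep u w (fromInj₁ (λ Bu → ⊥-elim (¬Bu Bu)) (cover u)) ¬Bu
      (fromInj₁ (λ Aw → ⊥-elim (¬Aw Aw)) (swap (cover w))) ¬Aw uw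

  walk-meets-separator : ∀ {A B} → IsSeparation G (A , B) → ∀ {S u w} →
    Walk G S u w → B u → A w → ∃ λ k → S k × A k × B k
  walk-meets-separator {B = B} sepAB {w = w} W Bu Aw with dec (B w)
  ... | yes Bw = w , walk-end W , Aw , Bw
  ... | no ¬Bw with exit B W Bu ¬Bw
  ...   | k , q , W′ , ¬Bq , kq =
    k , proj₁ (walk-end W′) , neighbour∈A sepAB (~-sym kq) ¬Bq , proj₂ (walk-end W′)

  connected-avoiding-separator-stays-on-side : ∀ {C D K} → IsSeparation G (C , D) →
    ConnectedIn G K → (∀ x → K x → ¬ (C x × D x)) → ∀ {x y} → K x → K y → D x → D y
  connected-avoiding-separator-stays-on-side {D = D} {K} sepCD K-conn K∩X=∅ {x} {y} Kx Ky =
    walk-preserves D across-edge (K-conn x y Kx Ky)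
    where
    across-edge : ∀ {x y} → K x → K y → x ~ y → D x → D y
    across-edge {x} Kx _ xy Dx = neighbour∈A (IsSeparation-swap sepCD) xy (λ Cx → K∩X=∅ x Kx (Cx , Dx))

  module _ {A B C D : Subset V} (connected : Connected G)
           (sepAB : IsSeparation G (A , B)) (sepCD : IsSeparation G (C , D))
           (absorbs : Absorbs G (A , B) (C , D)) where

    private
      X⊆A : ∀ x → C x → D x → A x
      X⊆A = proj₁ absorbs

      N⊆A : ∀ x y → C x → D x → x ~ y → ¬ D y → A y
      N⊆A = proj₂ absorbs

    module _ {T : Subset V} (T-conn : ConnectedIn G T) (T⊆B∖A : ∀ x → T x → B x × ¬ A x)
             (separator⊆N : ∀ x → A x → B x → N G T x) where

      private
        T∩X=∅ : ∀ x → T x → ¬ (C x × D x)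
        T∩X=∅ x Tx (Cx , Dx) = proj₂ (T⊆B∖A x Tx) (X⊆A x Cx Dx)

        side : ∀ {x y} → T x → T y → D x → D y
        side = connected-avoiding-separator-stays-on-side sepCD T-conn T∩X=∅

        separator-neighbour : ∀ {x} → A x → B x → ∃ λ τ → T τ × τ ~ x
        separator-neighbour Ax Bx = let _ , τ , Tτ , τx = separator⊆N _ Ax Bx in τ , Tτ , τx

      component-in-D⇒B⊆D : ∀ {t} → T t → D t → ∀ b → B b → D b
      component-in-D⇒B⊆D {t} Tt Dt b Bb = stable λ ¬Db →
        let p , q , W , ¬¬Dq , pq = exit (λ x → ¬ D x) (connected b t) ¬Db (λ ¬Dt → ¬Dt Dt)
            ¬Dp = proj₂ (walk-end W)
            Ap = N⊆A q p (neighbour∈A sepCD pq ¬Dp) (stable ¬¬Dq) (~-sym pq) ¬Dp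
            k , (_ , ¬Dk) , Ak , Bk = walk-meets-separator sepAB W Bb Ap
        in ¬Dk (separator⊆D k Ak Bk)
        where
        separator⊆D : ∀ x → A x → B x → D x
        separator⊆D x Ax Bx =
          let τ , Tτ , τx = separator-neighbour Ax Bx
          in neighbour∈A (IsSeparation-swap sepCD) τx (λ Cτ → T∩X=∅ τ Tτ (Cτ , side Tt Tτ Dt))

      component-outside-D⇒B∩D=∅ : ∀ {t} → T t → ¬ D t → ∀ v → B v → ¬ D v
      component-outside-D⇒B∩D=∅ {t} Tt ¬Dt v Bv Dv =
        let p , q , W , ¬Dq , pq = exit D (connected v t) Dv ¬Dt
            Dp = proj₂ (walk-end W)
            Ap = X⊆A p (neighbour∈A sepCD (~-sym pq) ¬Dq) Dp
            k , (_ , Dk) , Ak , Bk = walk-meets-separator sepAB W Bv Ap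
        in separator⊆∁D k Ak Bk Dk
        where
        separator⊆∁D : ∀ x → A x → B x → ¬ D x
        separator⊆∁D x Ax Bx Dx =
          let τ , Tτ , τx = separator-neighbour Ax Bx
              ¬Dτ = λ Dτ → ¬Dt (side Tτ Tt Dτ)
          in proj₂ (T⊆B∖A τ Tτ) (N⊆A x τ (neighbour∈A sepCD τx ¬Dτ) Dx (~-sym τx) ¬Dτ)

    absorbs⇒≤s : IsTight G (A , B) → ∀ {v} → B v → D v → _≤s_ G (C , D) (A , B)
    absorbs⇒≤s (_ , T , (((t , Tt) , _ , T-conn , _) , N≐) , T⊆B∖A) {v} Bv Dv = C⊆A , B⊆D
      where
      separator⊆N : ∀ x → A x → B x → N G T x
      separator⊆N x Ax Bx = proj₂ N≐ x (Ax , Bx)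

      B⊆D : ∀ b → B b → D b
      B⊆D with dec (D t)
      ... | yes Dt = component-in-D⇒B⊆D T-conn T⊆B∖A separator⊆N Tt Dt
      ... | no ¬Dt = ⊥-elim (component-outside-D⇒B∩D=∅ T-conn T⊆B∖A separator⊆N Tt ¬Dt v Bv Dv)

      C⊆A : ∀ x → C x → A x
      C⊆A x Cx with dec (D x)
      ... | yes Dx = X⊆A x Cx Dx
      ... | no ¬Dx = fromInj₁ (λ Bx → ⊥-elim (¬Dx (B⊆D x Bx))) (proj₁ sepAB x)

  eventually-absorbs : LocallyFinite G → (s : ℕ → OSep G) → StrictlyIncreasing G s →
    ∀ {C D} → IsSeparation G (C , D) → FiniteOrder G (C , D) →
    (∀ x → C x → OSep.A (limit G s) x) → ∃ λ I → Absorbs G (s I) (C , D)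
  eventually-absorbs locally-finite s increasing {C} {D} sepCD (X , X-enum) C⊆⋃A =
    let I , covered = I-covered in
    I , (λ x Cx Dx → covered x (x∈X Cx Dx) x (here refl) Cx) ,
        (λ x y Cx Dx xy ¬Dy → covered x (x∈X Cx Dx) y (there (y∈nbrs x xy))
                                (fromInj₁ (λ Dy → ⊥-elim (¬Dy Dy)) (proj₁ sepCD y)))
    where
    A : ℕ → Subset V
    A i = OSep.A (s i)

    A-mono : ∀ {i j x} → i ≤ j → A i x → A j x
    A-mono {i} {j} {x} i≤j with m≤n⇒m<n∨m≡n i≤j
    ... | inj₁ i<j = proj₁ (proj₁ (increasing i j i<j)) x
    ... | inj₂ refl = λ Ax → Ax

    nbrs : V → List V
    nbrs x = proj₁ (locally-finite x)

    y∈nbrs : ∀ x {y} → x ~ y → y ∈ nbrs x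
    y∈nbrs x {y} = Equivalence.to (proj₂ (locally-finite x) y)

    x∈X : ∀ {x} → C x → D x → x ∈ X
    x∈X {x} Cx Dx = Equivalence.to (X-enum x) (Cx , Dx)

    C⇒A : ℕ → V → Set
    C⇒A i y = C y → A i y

    closed-neighbourhood⊆A : ℕ → V → Set
    closed-neighbourhood⊆A i x = ∀ y → y ∈ x ∷ nbrs x → C⇒A i y

    eventually-C⇒A : ∀ y → ∃ λ i → C⇒A i y
    eventually-C⇒A y with dec (C y)
    ... | yes Cy = let i , Ay = C⊆⋃A y Cy in i , λ _ → Ay
    ... | no ¬Cy = 0 , λ Cy → ⊥-elim (¬Cy Cy)

    I-covered : ∃ λ I → ∀ x → x ∈ X → closed-neighbourhood⊆A I x
    I-covered = eventually-all closed-neighbourhood⊆A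
      (λ i≤j h y y∈ Cy → A-mono i≤j (h y y∈ Cy))
      X
      (λ x _ → eventually-all C⇒A (λ i≤j h Cy → A-mono i≤j (h Cy)) (x ∷ nbrs x)
                 (λ y _ → eventually-C⇒A y))

open Classical

lemma3p11 : ExcludedMiddle (Level.suc 0ℓ) →
    (G : Graph) → Connected G → LocallyFinite G →
    (s : ℕ → OSep G) →
    (∀ i → IsSeparation G (s i)) → (∀ i → IsTight G (s i)) →
    StrictlyIncreasing G s →
    (cd : OSep G) → IsSeparation G cd → FiniteOrder G cd →
    NonExhaustive G s → _≤s_ G cd (limit G s) →
    ∃ λ I → _≤s_ G cd (s I)
lemma3p11 em G connected locally-finite s separation tight increasing
          (C , D) sepCD finite (v , v∈⋂B) (C⊆⋃A , ⋂B⊆D) =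
  let I , absorbs = eventually-absorbs em G locally-finite s increasing sepCD finite C⊆⋃A
  in I , absorbs⇒≤s em G connected (separation I) sepCD absorbs (tight I) (v∈⋂B I) (⋂B⊆D v v∈⋂B)
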